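{- Let $\Sigma=\{0,1\}$ and let $\varepsilon$ denote the empty word. Suppose $\varphi:\Sigma^*\times\Sigma^*\to{\rm SL}(3,\mathbb{Z})$ is an injective morphism, and let $A=\varphi((0,\varepsilon))$, $B=\varphi((1,\varepsilon))$, $C=\varphi((\varepsilon,0))$, $D=\varphi((\varepsilon,1))$. Then none of $A,B,C,D$ has a Jordan normal form of the type $\begin{pmatrix}\lambda&0&0\\0&\mu&0\\0&0&\mu\end{pmatrix}$ with $\lambda\neq\mu$.
   Context: $\Sigma^*\times\Sigma^*$ is the direct product monoid of pairs of words with componentwise concatenation; a morphism is a map $\varphi$ with $\varphi(xy)=\varphi(x)\varphi(y)$. ${\rm SL}(3,\mathbb{Z})$ is the group of integer $3\times 3$ matrices of determinant $1$. -}

module Defs where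

open import Level using (Level; _⊔_; suc)
open import Data.Bool using (Bool)
open import Data.List using (List; [])
open import Data.Product using (_×_; _,_; ∃; ∃-syntax; Σ-syntax)
open import Data.Fin using (Fin; zero) renaming (suc to fs)
open import Data.Nat as ℕ using (ℕ)
open import Data.Integer as Int using (ℤ; +_; -[1+_])
open import Relation.Nullary using (¬_)
open import Relation.Binary.PropositionalEquality using (_≡_)
open import Algebra.Bundles using (CommutativeRing)

-- Σ = {0,1} is represented by Bool (false = 0, true = 1);
-- Σ* × Σ* is List Bool × List Bool with componentwise concatenation.
Word2 : Set
Word2 = List Bool × List Bool

Mat3 : ∀ {a} → Set a → Set a
Mat3 A = Fin 3 → Fin 3 → A

i0 i1 i2 : Fin 3
i0 = zero
i1 = fs zero
i2 = fs (fs zero)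

module _ where
  open Int using (_+_; _*_; _-_)

  _⊗ℤ_ : Mat3 ℤ → Mat3 ℤ → Mat3 ℤ
  (M ⊗ℤ N) i j = M i i0 * N i0 j + M i i1 * N i1 j + M i i2 * N i2 j

  detℤ : Mat3 ℤ → ℤ
  detℤ M =
      M i0 i0 * (M i1 i1 * M i2 i2 - M i1 i2 * M i2 i1)
    - M i0 i1 * (M i1 i0 * M i2 i2 - M i1 i2 * M i2 i0)
    + M i0 i2 * (M i1 i0 * M i2 i1 - M i1 i1 * M i2 i0)

_≈ℤ_ : Mat3 ℤ → Mat3 ℤ → Set
M ≈ℤ N = ∀ i j → M i j ≡ N i j

IntoSL3 : (Word2 → Mat3 ℤ) → Set
IntoSL3 φ = ∀ w → detℤ (φ w) ≡ + 1

IsMorphism : (Word2 → Mat3 ℤ) → Set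
IsMorphism φ = ∀ x₁ x₂ y₁ y₂ →
  φ (x₁ Data.List.++ y₁ , x₂ Data.List.++ y₂) ≈ℤ (φ (x₁ , x₂) ⊗ℤ φ (y₁ , y₂))

IsInjective : (Word2 → Mat3 ℤ) → Set
IsInjective φ = ∀ u v → φ u ≈ℤ φ v → u ≡ v

-- A field of characteristic zero (a commutative ring, 1 ≠ 0, nonzero elements
-- invertible, n·1 ≠ 0 for n ≥ 1).  ℂ is an instance; ℂ itself is not available.
-- n ↦ n · 1 in a commutative ring
ringℕ : ∀ {c ℓ} (R : CommutativeRing c ℓ) → ℕ → CommutativeRing.Carrier R
ringℕ R ℕ.zero = CommutativeRing.0# R
ringℕ R (ℕ.suc n) = CommutativeRing._+_ R (CommutativeRing.1# R) (ringℕ R n)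

record CharZeroField c ℓ : Set (suc (c ⊔ ℓ)) where
  field
    cring : CommutativeRing c ℓ
  open CommutativeRing cring public
  field
    nontrivial : ¬ (1# ≈ 0#)
    inverse    : ∀ x → ¬ (x ≈ 0#) → ∃[ y ] (x * y ≈ 1#)
    charZero   : ∀ n → ¬ (ringℕ cring (ℕ.suc n) ≈ 0#)

module FieldOps {c ℓ} (K : CharZeroField c ℓ) where
  open CharZeroField K

  natK : ℕ → Carrier
  natK = ringℕ cring

  intK : ℤ → Carrier
  intK (+ n) = natK n
  intK -[1+ n ] = - natK (ℕ.suc n)

  mapK : Mat3 ℤ → Mat3 Carrier
  mapK M i j = intK (M i j)

  _⊗_ : Mat3 Carrier → Mat3 Carrier → Mat3 Carrier
  (M ⊗ N) i j = M i i0 * N i0 j + M i i1 * N i1 j + M i i2 * N i2 j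

  _≋_ : Mat3 Carrier → Mat3 Carrier → Set ℓ
  M ≋ N = ∀ i j → M i j ≈ N i j

  idK : Mat3 Carrier
  idK zero zero = 1#
  idK (fs zero) (fs zero) = 1#
  idK (fs (fs zero)) (fs (fs zero)) = 1#
  idK _ _ = 0#

  diag3 : Carrier → Carrier → Carrier → Mat3 Carrier
  diag3 a b c zero zero = a
  diag3 a b c (fs zero) (fs zero) = b
  diag3 a b c (fs (fs zero)) (fs (fs zero)) = c
  diag3 a b c _ _ = 0#

HasJNF-λμμ : ∀ {c ℓ} (K : CharZeroField c ℓ) → Mat3 ℤ → Set (c ⊔ ℓ)
HasJNF-λμμ K M =
  ∃[ l ] ∃[ m ] (¬ (l ≈ m)) ×
  (∃[ P ] ∃[ Q ] ((P ⊗ Q) ≋ idK) × ((Q ⊗ P) ≋ idK) ×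
     (mapK M ≋ ((P ⊗ diag3 l m m) ⊗ Q)))
  where open CharZeroField K
        open FieldOps K

-- Write the integer matrix as P · diag(λ, μ, μ) · P⁻¹ over K. Splitting off the
-- first eigenvector, it is μ I + (λ − μ) u wᵀ with w · u = 1, so its trace t, its
-- second invariant e and its determinant 1 satisfy t = λ + 2μ, e = 2λμ + μ²,
-- λμ² = 1. Eliminating λ expresses μ as the rational number (te − 9) / 2(t² − 3e),
-- and μ is a root of the monic integer cubic x³ − t x² + e x − 1, so μ is an
-- integer; then λμ² = 1 forces λ = 1, μ = −1. Such a matrix squares to the
-- identity, so φ(x x x) = φ(x) for the generator x, contradicting injectivity.
module Submission where

open import Defs
open import Data.Bool using (true; false)
open import Data.List using ([]; [_])
open import Data.Product using (_×_; _,_)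
open import Relation.Nullary using (¬_)
open import Level using (Level)
open import Data.Integer using (ℤ)

open import Algebra.Bundles using (RawRing)
open import Algebra.Solver.Ring.AlmostCommutativeRing
  using (fromCommutativeRing; _-Raw-AlmostCommutative⟶_)
open import Data.Empty using (⊥-elim)
open import Data.Fin using (Fin; combine; remQuot; #_) renaming (zero to fz; suc to fs)
open import Data.Integer as ℤ using (+_; -[1+_]; _⊖_; 0ℤ; 1ℤ; -1ℤ; ∣_∣)
open import Data.Integer.Coprimality using (Coprime; coprime-divisor)
import Data.Integer.Divisibility as ℤ∣
import Data.Integer.Divisibility.Signed as ℤ∣ˢ
import Data.Integer.Properties as ℤP
open import Data.List using (_++_)
open import Data.Maybe using (Maybe; just; nothing)
open import Data.Nat as ℕ using (ℕ; zero; suc)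
import Data.Nat.Coprimality as ℕC
open import Data.Nat.DivMod using (_/_; m*n/n≡m)
import Data.Nat.Divisibility as ℕ∣
open import Data.Nat.GCD using (gcd; gcd[m,n]∣m; gcd[m,n]∣n; gcd[m,n]≢0)
import Data.Nat.Properties as ℕP
open import Data.Product using (∃-syntax; Σ-syntax; proj₁; proj₂; uncurry)
open import Data.Sum using (_⊎_; inj₁; inj₂)
open import Data.Vec using (Vec; _∷_; []; lookup; tabulate)
open import Data.Vec.Relation.Binary.Pointwise.Inductive as Pointwise
  using (Pointwise; _∷_; [])
open import Relation.Binary.PropositionalEquality as ≡ using (_≡_; _≢_)
open import Relation.Nullary using (yes; no)

lowest-terms : ∀ a b → a ≢ 0ℤ →
  Σ[ g ∈ ℕ ] Σ[ a₀ ∈ ℤ ] Σ[ b₀ ∈ ℤ ]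
    g ≢ 0 × a ≡ a₀ ℤ.* + g × b ≡ b₀ ℤ.* + g × Coprime a₀ b₀
lowest-terms a b a≢0 = g , a₀ , b₀ , g≢0 , a≡a₀g , b≡b₀g , coprime
  where
  g = gcd ∣ a ∣ ∣ b ∣
  g≢0 = gcd[m,n]≢0 ∣ a ∣ ∣ b ∣ (inj₁ (λ ∣a∣≡0 → a≢0 (ℤP.∣i∣≡0⇒i≡0 ∣a∣≡0)))
  instance
    _ = ℕ.≢-nonZero g≢0
  g∣a = ℤ∣ˢ.∣ᵤ⇒∣ {+ g} {a} (gcd[m,n]∣m ∣ a ∣ ∣ b ∣)
  g∣b = ℤ∣ˢ.∣ᵤ⇒∣ {+ g} {b} (gcd[m,n]∣n ∣ a ∣ ∣ b ∣)
  a₀ = ℤ∣ˢ.quotient g∣a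
  b₀ = ℤ∣ˢ.quotient g∣b
  a≡a₀g = ℤ∣ˢ._∣_.equality g∣a
  b≡b₀g = ℤ∣ˢ._∣_.equality g∣b
  ∣quotient∣ : ∀ {i} q → i ≡ q ℤ.* + g → ∣ q ∣ ≡ ∣ i ∣ / g
  ∣quotient∣ q i≡qg = ≡.trans (≡.sym (m*n/n≡m ∣ q ∣ g))
    (≡.cong (_/ g) (≡.trans (≡.sym (ℤP.abs-* q (+ g))) (≡.cong ∣_∣ (≡.sym i≡qg))))
  coprime = ≡.subst₂ ℕC.Coprime
    (≡.sym (∣quotient∣ a₀ a≡a₀g)) (≡.sym (∣quotient∣ b₀ b≡b₀g)) (ℕC.coprime-/gcd ∣ a ∣ ∣ b ∣)

coprime-∣-cube⇒unit : ∀ {a b} → Coprime a b → a ℤ∣.∣ b ℤ.* (b ℤ.* b) → ∣ a ∣ ≡ 1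
coprime-∣-cube⇒unit {a} {b} coprime a∣b³ = coprime (ℕ∣.∣-refl , a∣b)
  where
  a∣b = coprime-divisor a b b coprime (coprime-divisor a b (b ℤ.* b) coprime a∣b³)

∣i∣≡1⇒i≡±1 : ∀ {i} → ∣ i ∣ ≡ 1 → i ≡ 1ℤ ⊎ i ≡ -1ℤ
∣i∣≡1⇒i≡±1 {+ suc zero} _ = inj₁ ≡.refl
∣i∣≡1⇒i≡±1 { -[1+ zero ]} _ = inj₂ ≡.refl
∣i∣≡1⇒i≡±1 {+ zero} ()
∣i∣≡1⇒i≡±1 {+ suc (suc _)} ()
∣i∣≡1⇒i≡±1 { -[1+ suc _ ]} ()

∣i∣≡1⇒i*i≡1 : ∀ {i} → ∣ i ∣ ≡ 1 → i ℤ.* i ≡ 1ℤ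
∣i∣≡1⇒i*i≡1 {i} ∣i∣≡1 with ∣i∣≡1⇒i≡±1 {i} ∣i∣≡1
... | inj₁ ≡.refl = ≡.refl
... | inj₂ ≡.refl = ≡.refl

i*[j*j]≡1⇒i≡1×∣j∣≡1 : ∀ i j → i ℤ.* (j ℤ.* j) ≡ 1ℤ → i ≡ 1ℤ × ∣ j ∣ ≡ 1
i*[j*j]≡1⇒i≡1×∣j∣≡1 i j eq = i≡1 , ∣j∣≡1
  where
  ∣j∣²≡1 : ∣ j ∣ ℕ.* ∣ j ∣ ≡ 1
  ∣j∣²≡1 = ℕP.m*n≡1⇒n≡1 ∣ i ∣ _ (≡.trans
    (≡.sym (≡.trans (ℤP.abs-* i (j ℤ.* j)) (≡.cong (∣ i ∣ ℕ.*_) (ℤP.abs-* j j))))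
    (≡.cong ∣_∣ eq))
  ∣j∣≡1 = ℕP.m*n≡1⇒m≡1 ∣ j ∣ ∣ j ∣ ∣j∣²≡1
  i≡1 = ≡.trans (≡.sym (ℤP.*-identityʳ i))
    (≡.trans (≡.cong (i ℤ.*_) (≡.sym (∣i∣≡1⇒i*i≡1 {j} ∣j∣≡1))) eq)

-- Instantiated at ℤ, at K and at solver polynomials; the polynomial instances
-- evaluate definitionally to the ones over K, and over ℤ, det is detℤ.
module Mat3Poly {a ℓ} (R : RawRing a ℓ) where
  open RawRing R

  infixl 6 _-_
  _-_ : Carrier → Carrier → Carrier
  x - y = x + - y

  infixl 7 _·_
  _·_ : Mat3 Carrier → Mat3 Carrier → Mat3 Carrier
  (M · N) i j = M i i0 * N i0 j + M i i1 * N i1 j + M i i2 * N i2 j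

  tr e₂ det : Mat3 Carrier → Carrier
  tr M = M i0 i0 + M i1 i1 + M i2 i2
  e₂ M = (M i0 i0 * M i1 i1 - M i0 i1 * M i1 i0)
       + (M i0 i0 * M i2 i2 - M i0 i2 * M i2 i0)
       + (M i1 i1 * M i2 i2 - M i1 i2 * M i2 i1)
  det M =
      M i0 i0 * (M i1 i1 * M i2 i2 - M i1 i2 * M i2 i1)
    - M i0 i1 * (M i1 i0 * M i2 i2 - M i1 i2 * M i2 i0)
    + M i0 i2 * (M i1 i0 * M i2 i1 - M i1 i1 * M i2 i0)

  1ᴹ : Mat3 Carrier
  1ᴹ fz fz = 1#
  1ᴹ (fs fz) (fs fz) = 1#
  1ᴹ (fs (fs fz)) (fs (fs fz)) = 1#
  1ᴹ _ _ = 0#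

  diag : Carrier → Carrier → Carrier → Mat3 Carrier
  diag x y z fz fz = x
  diag x y z (fs fz) (fs fz) = y
  diag x y z (fs (fs fz)) (fs (fs fz)) = z
  diag x y z _ _ = 0#

  infix 7 _∙_
  _∙_ : (Fin 3 → Carrier) → (Fin 3 → Carrier) → Carrier
  w ∙ u = w i0 * u i0 + w i1 * u i1 + w i2 * u i2

  -- The identity I is a parameter because idK and 1ᴹ agree only entrywise at
  -- concrete indices.
  rankOne : Mat3 Carrier → Carrier → Carrier → (Fin 3 → Carrier) → (Fin 3 → Carrier) → Mat3 Carrier
  rankOne I x c u w i j = x * I i j + c * (u i * w j)

module ℤᴹ = Mat3Poly ℤ.+-*-rawRing

vec3 : ∀ {a} {A : Set a} → A → A → A → Fin 3 → A
vec3 x y z fz = x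
vec3 x y z (fs fz) = y
vec3 x y z (fs (fs fz)) = z

entries : ∀ {a} {A : Set a} → Mat3 A → Vec A 9
entries M = tabulate (λ k → uncurry M (remQuot 3 k))

module _ {c ℓ} (K : CharZeroField c ℓ) where
  open CharZeroField K
  open FieldOps K
  open import Relation.Binary.Reasoning.Setoid setoid
  open import Algebra.Properties.AbelianGroup +-abelianGroup using (⁻¹-∙-comm)
  open import Algebra.Properties.Group +-group using (⁻¹-involutive; ε⁻¹≈ε; x≈y⇒x∙y⁻¹≈ε)
  open import Algebra.Properties.Ring ring using (-‿distribˡ-*)
  open import Algebra.Properties.Semiring.Exp semiring using (_^_; ^-congˡ)

  module Kᴹ = Mat3Poly rawRing

  [x+a]-[x+b]≈a-b : ∀ x a b → (x + a) - (x + b) ≈ a - b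
  [x+a]-[x+b]≈a-b x a b = begin
    (x + a) + - (x + b)   ≈⟨ +-congˡ (sym (⁻¹-∙-comm x b)) ⟩
    (x + a) + (- x + - b) ≈⟨ sym (+-assoc _ _ _) ⟩
    ((x + a) + - x) + - b ≈⟨ +-congʳ (+-congʳ (+-comm x a)) ⟩
    ((a + x) + - x) + - b ≈⟨ +-congʳ (+-assoc _ _ _) ⟩
    (a + (x + - x)) + - b ≈⟨ +-congʳ (+-congˡ (-‿inverseʳ x)) ⟩
    (a + 0#) + - b        ≈⟨ +-congʳ (+-identityʳ a) ⟩
    a + - b               ∎

  -x≈0⇒x≈0 : ∀ {x} → - x ≈ 0# → x ≈ 0#
  -x≈0⇒x≈0 {x} -x≈0 = trans (sym (⁻¹-involutive x)) (trans (-‿cong -x≈0) ε⁻¹≈ε)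

  natK-+ : ∀ m n → natK (m ℕ.+ n) ≈ natK m + natK n
  natK-+ zero n = sym (+-identityˡ _)
  natK-+ (suc m) n = trans (+-congˡ (natK-+ m n)) (sym (+-assoc _ _ _))

  intK-⊖ : ∀ m n → intK (m ⊖ n) ≈ natK m - natK n
  intK-⊖ m zero = sym (trans (+-congˡ ε⁻¹≈ε) (+-identityʳ _))
  intK-⊖ zero (suc n) = sym (+-identityˡ _)
  intK-⊖ (suc m) (suc n) = begin
    intK (suc m ⊖ suc n)    ≡⟨ ≡.cong intK (ℤP.[1+m]⊖[1+n]≡m⊖n m n) ⟩
    intK (m ⊖ n)            ≈⟨ intK-⊖ m n ⟩
    natK m - natK n         ≈⟨ sym ([x+a]-[x+b]≈a-b 1# _ _) ⟩
    natK (suc m) - natK (suc n) ∎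

  intK-neg : ∀ i → intK (ℤ.- i) ≈ - intK i
  intK-neg (+ zero) = sym ε⁻¹≈ε
  intK-neg (+ suc n) = refl
  intK-neg -[1+ n ] = sym (⁻¹-involutive _)

  intK-+ : ∀ i j → intK (i ℤ.+ j) ≈ intK i + intK j
  intK-+ (+ m) (+ n) = natK-+ m n
  intK-+ (+ m) -[1+ n ] = intK-⊖ m (suc n)
  intK-+ -[1+ m ] (+ n) = trans (intK-⊖ n (suc m)) (+-comm _ _)
  intK-+ -[1+ m ] -[1+ n ] = begin
    - natK (suc (suc (m ℕ.+ n)))       ≡⟨ ≡.cong (λ k → - natK (suc k)) (≡.sym (ℕP.+-suc m n)) ⟩
    - natK (suc m ℕ.+ suc n)           ≈⟨ -‿cong (natK-+ (suc m) (suc n)) ⟩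
    - (natK (suc m) + natK (suc n))    ≈⟨ sym (⁻¹-∙-comm _ _) ⟩
    - natK (suc m) + - natK (suc n)    ∎

  intK-*⁺ : ∀ m j → intK (+ m ℤ.* j) ≈ natK m * intK j
  intK-*⁺ zero j = sym (zeroˡ _)
  intK-*⁺ (suc m) j = begin
    intK (+ suc m ℤ.* j)              ≡⟨ ≡.cong intK (ℤP.suc-* (+ m) j) ⟩
    intK (j ℤ.+ + m ℤ.* j)            ≈⟨ intK-+ j _ ⟩
    intK j + intK (+ m ℤ.* j)         ≈⟨ +-cong (sym (*-identityˡ _)) (intK-*⁺ m j) ⟩
    1# * intK j + natK m * intK j     ≈⟨ sym (distribʳ _ _ _) ⟩
    natK (suc m) * intK j             ∎

  intK-* : ∀ i j → intK (i ℤ.* j) ≈ intK i * intK j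
  intK-* (+ m) j = intK-*⁺ m j
  intK-* -[1+ m ] j = begin
    intK (-[1+ m ] ℤ.* j)             ≡⟨ ≡.cong intK (≡.sym (ℤP.neg-distribˡ-* (+ suc m) j)) ⟩
    intK (ℤ.- (+ suc m ℤ.* j))        ≈⟨ intK-neg (+ suc m ℤ.* j) ⟩
    - intK (+ suc m ℤ.* j)            ≈⟨ -‿cong (intK-*⁺ (suc m) j) ⟩
    - (natK (suc m) * intK j)         ≈⟨ -‿distribˡ-* _ _ ⟩
    - natK (suc m) * intK j           ∎

  intK-^ : ∀ i n → intK (i ℤ.^ n) ≈ intK i ^ n
  intK-^ i zero = +-identityʳ 1#
  intK-^ i (suc n) = trans (intK-* i (i ℤ.^ n)) (*-congˡ (intK-^ i n))

  intK≈0⇒≡0 : ∀ {i} → intK i ≈ 0# → i ≡ 0ℤ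
  intK≈0⇒≡0 {+ zero} _ = ≡.refl
  intK≈0⇒≡0 {+ suc n} h = ⊥-elim (charZero n h)
  intK≈0⇒≡0 { -[1+ n ]} h = ⊥-elim (charZero n (-x≈0⇒x≈0 h))

  intK-injective : ∀ {i j} → intK i ≈ intK j → i ≡ j
  intK-injective {i} {j} h = ℤP.i-j≡0⇒i≡j i j (intK≈0⇒≡0 (begin
    intK (i ℤ.+ ℤ.- j)      ≈⟨ intK-+ i (ℤ.- j) ⟩
    intK i + intK (ℤ.- j)   ≈⟨ +-cong h (intK-neg j) ⟩
    intK j + - intK j       ≈⟨ -‿inverseʳ _ ⟩
    0#                      ∎))

  -- Agrees with intK, but sends 0, 1 and −1 to 0#, 1# and - 1# on the nose, so
  -- that constant polynomials evaluate to exactly the entries of idK and diag3.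
  fromℤ : ℤ → Carrier
  fromℤ (+ zero) = 0#
  fromℤ (+ suc zero) = 1#
  fromℤ (+ suc (suc n)) = intK (+ suc (suc n))
  fromℤ -[1+ zero ] = - 1#
  fromℤ -[1+ suc n ] = intK -[1+ suc n ]

  fromℤ≈intK : ∀ i → fromℤ i ≈ intK i
  fromℤ≈intK (+ zero) = refl
  fromℤ≈intK (+ suc zero) = sym (+-identityʳ _)
  fromℤ≈intK (+ suc (suc n)) = refl
  fromℤ≈intK -[1+ zero ] = -‿cong (sym (+-identityʳ _))
  fromℤ≈intK -[1+ suc n ] = refl

  fromℤ-morphism : ℤ.+-*-rawRing -Raw-AlmostCommutative⟶ fromCommutativeRing cring
  fromℤ-morphism = record
    { ⟦_⟧ = fromℤ
    ; +-homo = λ i j → via (i ℤ.+ j) (intK-+ i j) (+-cong (sym (fromℤ≈intK i)) (sym (fromℤ≈intK j)))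
    ; *-homo = λ i j → via (i ℤ.* j) (intK-* i j) (*-cong (sym (fromℤ≈intK i)) (sym (fromℤ≈intK j)))
    ; -‿homo = λ i → via (ℤ.- i) (intK-neg i) (-‿cong (sym (fromℤ≈intK i)))
    ; 0-homo = refl
    ; 1-homo = refl
    }
    where
    via : ∀ i {y z} → intK i ≈ y → y ≈ z → fromℤ i ≈ z
    via i p q = trans (fromℤ≈intK i) (trans p q)

  fromℤ-≟ : ∀ i j → Maybe (fromℤ i ≈ fromℤ j)
  fromℤ-≟ i j with i ℤ.≟ j
  ... | yes ≡.refl = just refl
  ... | no _ = nothing

  open import Algebra.Solver.Ring ℤ.+-*-rawRing (fromCommutativeRing cring) fromℤ-morphism fromℤ-≟

  polyRing : ℕ → RawRing _ _
  polyRing n = record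
    { Carrier = Polynomial n ; _≈_ = _≡_ ; _+_ = _:+_ ; _*_ = _:*_ ; -_ = :-_
    ; 0# = con 0ℤ ; 1# = con 1ℤ }

  module Pᴹ {n} = Mat3Poly (polyRing n)

  ⟦_⟧ℤ : ∀ {n} → Polynomial n → Vec ℤ n → ℤ
  ⟦ op [+] p q ⟧ℤ ρ = ⟦ p ⟧ℤ ρ ℤ.+ ⟦ q ⟧ℤ ρ
  ⟦ op [*] p q ⟧ℤ ρ = ⟦ p ⟧ℤ ρ ℤ.* ⟦ q ⟧ℤ ρ
  ⟦ con i ⟧ℤ ρ = i
  ⟦ var x ⟧ℤ ρ = lookup ρ x
  ⟦ p :^ k ⟧ℤ ρ = ⟦ p ⟧ℤ ρ ℤ.^ k
  ⟦ :- p ⟧ℤ ρ = ℤ.- ⟦ p ⟧ℤ ρ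

  _↦_ : ℤ → Carrier → Set ℓ
  i ↦ x = intK i ≈ x

  ⟦⟧-image : ∀ {n} (p : Polynomial n) {ρ σ} → Pointwise _↦_ ρ σ → ⟦ p ⟧ℤ ρ ↦ ⟦ p ⟧ σ
  ⟦⟧-image (op [+] p q) {ρ} ρ↦σ = trans (intK-+ (⟦ p ⟧ℤ ρ) (⟦ q ⟧ℤ ρ)) (+-cong (⟦⟧-image p ρ↦σ) (⟦⟧-image q ρ↦σ))
  ⟦⟧-image (op [*] p q) {ρ} ρ↦σ = trans (intK-* (⟦ p ⟧ℤ ρ) (⟦ q ⟧ℤ ρ)) (*-cong (⟦⟧-image p ρ↦σ) (⟦⟧-image q ρ↦σ))
  ⟦⟧-image (con i) ρ↦σ = sym (fromℤ≈intK i)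
  ⟦⟧-image (var x) ρ↦σ = Pointwise.lookup ρ↦σ x
  ⟦⟧-image (p :^ k) {ρ} ρ↦σ = trans (intK-^ (⟦ p ⟧ℤ ρ) k) (^-congˡ k (⟦⟧-image p ρ↦σ))
  ⟦⟧-image (:- p) {ρ} ρ↦σ = trans (intK-neg (⟦ p ⟧ℤ ρ)) (-‿cong (⟦⟧-image p ρ↦σ))

  -- The generic matrix: for every function F of Mat3Poly, ⟦ F 𝕄 ⟧ (entries N)
  -- computes to F N, so ⟦⟧-image transports matrix invariants along intK.
  𝕄 : Mat3 (Polynomial 9)
  𝕄 i j = var (combine i j)

  entries-image : ∀ {M N} → mapK M ≋ N → Pointwise _↦_ (entries M) (entries N)
  entries-image {M} {N} M≋N = Pointwise.tabulate⁺
    {f = λ k → uncurry M (remQuot 3 k)} {g = λ k → uncurry N (remQuot 3 k)}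
    (λ k → uncurry M≋N (remQuot 3 k))

  y≈0⇒x+z*y≈x : ∀ {x y} z → y ≈ 0# → x + z * y ≈ x
  y≈0⇒x+z*y≈x {x} z y≈0 = trans (+-congˡ (trans (*-congˡ y≈0) (zeroʳ z))) (+-identityʳ x)

  *-nonzero : ∀ {x y} → ¬ x ≈ 0# → ¬ y ≈ 0# → ¬ x * y ≈ 0#
  *-nonzero {x} {y} x≉0 y≉0 xy≈0 with inverse x x≉0 | inverse y y≉0
  ... | x⁻¹ , xx⁻¹≈1 | y⁻¹ , yy⁻¹≈1 = nontrivial (begin
    1#                    ≈⟨ sym (*-identityʳ 1#) ⟩
    1# * 1#               ≈⟨ *-cong (sym xx⁻¹≈1) (sym yy⁻¹≈1) ⟩
    (x * x⁻¹) * (y * y⁻¹) ≈⟨ solve 4 (λ x x⁻¹ y y⁻¹ → (x :* x⁻¹) :* (y :* y⁻¹) := (x :* y) :* (x⁻¹ :* y⁻¹)) refl x x⁻¹ y y⁻¹ ⟩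
    (x * y) * (x⁻¹ * y⁻¹) ≈⟨ *-congʳ xy≈0 ⟩
    0# * (x⁻¹ * y⁻¹)      ≈⟨ zeroˡ _ ⟩
    0#                    ∎)

  *-cancelˡ : ∀ {a x y} → ¬ a ≈ 0# → a * x ≈ a * y → x ≈ y
  *-cancelˡ {a} {x} {y} a≉0 ax≈ay with inverse a a≉0
  ... | a⁻¹ , aa⁻¹≈1 = begin
    x               ≈⟨ sym (a⁻¹a* x) ⟩
    (a⁻¹ * a) * x   ≈⟨ *-assoc a⁻¹ a x ⟩
    a⁻¹ * (a * x)   ≈⟨ *-congˡ ax≈ay ⟩
    a⁻¹ * (a * y)   ≈⟨ sym (*-assoc a⁻¹ a y) ⟩
    (a⁻¹ * a) * y   ≈⟨ a⁻¹a* y ⟩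
    y               ∎
    where
    a⁻¹a* : ∀ z → (a⁻¹ * a) * z ≈ z
    a⁻¹a* z = trans (*-congʳ (trans (*-comm a⁻¹ a) aa⁻¹≈1)) (*-identityˡ z)

  x≉y⇒x-y≉0 : ∀ {l m} → ¬ l ≈ m → ¬ l - m ≈ 0#
  x≉y⇒x-y≉0 {l} {m} l≉m l-m≈0 = l≉m (begin
    l               ≈⟨ solve 2 (λ l m → l := (l :- m) :+ m) refl l m ⟩
    (l - m) + m     ≈⟨ +-congʳ l-m≈0 ⟩
    0# + m          ≈⟨ +-identityˡ m ⟩
    m               ∎)

  rational-root-integral : ∀ {a b p q r : ℤ} {x} → a ≢ 0ℤ → intK a * x ≈ intK b →
    x * x * x + intK p * (x * x) + intK q * x + intK r ≈ 0# → ∃[ z ] x ≈ intK z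
  rational-root-integral {a} {b} {p} {q} {r} {x} a≢0 ax≈b χ[x]≈0
    with lowest-terms a b a≢0
  ... | g , a₀ , b₀ , g≢0 , a≡a₀g , b≡b₀g , coprime = a₀ ℤ.* b₀ , x≈a₀b₀
    where
    A₀ B₀ G : Carrier
    A₀ = intK a₀
    B₀ = intK b₀
    G = intK (+ g)

    G≉0 : ¬ G ≈ 0#
    G≉0 G≈0 = g≢0 (ℤP.+-injective (intK≈0⇒≡0 G≈0))

    a₀x≈b₀ : A₀ * x ≈ B₀
    a₀x≈b₀ = *-cancelˡ G≉0 (begin
      G * (A₀ * x)         ≈⟨ solve 3 (λ g a x → g :* (a :* x) := (a :* g) :* x) refl G A₀ x ⟩
      (A₀ * G) * x         ≈⟨ *-congʳ (sym (intK-* a₀ (+ g))) ⟩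
      intK (a₀ ℤ.* + g) * x ≡⟨ ≡.cong (λ i → intK i * x) (≡.sym a≡a₀g) ⟩
      intK a * x           ≈⟨ ax≈b ⟩
      intK b               ≡⟨ ≡.cong intK b≡b₀g ⟩
      intK (b₀ ℤ.* + g)    ≈⟨ intK-* b₀ (+ g) ⟩
      B₀ * G               ≈⟨ *-comm B₀ G ⟩
      G * B₀               ∎)

    -- Clearing the denominator a₀³ from the cubic gives b₀³ = a₀ y.
    y : ℤ
    y = ℤ.- (p ℤ.* (b₀ ℤ.* b₀) ℤ.+ q ℤ.* (a₀ ℤ.* b₀) ℤ.+ r ℤ.* (a₀ ℤ.* a₀))

    𝕒 𝕓 𝕡 𝕢 𝕣 : Polynomial 5
    𝕒 = var (# 0)
    𝕓 = var (# 1)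
    𝕡 = var (# 2)
    𝕢 = var (# 3)
    𝕣 = var (# 4)

    images : Pointwise _↦_ (a₀ ∷ b₀ ∷ p ∷ q ∷ r ∷ []) (A₀ ∷ A₀ * x ∷ intK p ∷ intK q ∷ intK r ∷ [])
    images = refl ∷ sym a₀x≈b₀ ∷ refl ∷ refl ∷ refl ∷ []

    b₀³≡a₀y : b₀ ℤ.* (b₀ ℤ.* b₀) ≡ a₀ ℤ.* y
    b₀³≡a₀y = intK-injective (begin
      intK (b₀ ℤ.* (b₀ ℤ.* b₀))  ≈⟨ ⟦⟧-image (𝕓 :* (𝕓 :* 𝕓)) images ⟩
      (A₀ * x) * ((A₀ * x) * (A₀ * x))
        ≈⟨ solve 5 (λ a x p q r →
             (a :* x) :* ((a :* x) :* (a :* x))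
               := a :* :- (p :* ((a :* x) :* (a :* x)) :+ q :* (a :* (a :* x)) :+ r :* (a :* a))
                  :+ (a :* (a :* a)) :* (x :* x :* x :+ p :* (x :* x) :+ q :* x :+ r))
             refl A₀ x (intK p) (intK q) (intK r) ⟩
      Y + (A₀ * (A₀ * A₀)) * (x * x * x + intK p * (x * x) + intK q * x + intK r)
        ≈⟨ y≈0⇒x+z*y≈x _ χ[x]≈0 ⟩
      Y                          ≈⟨ sym (⟦⟧-image (𝕒 :* :- (𝕡 :* (𝕓 :* 𝕓) :+ 𝕢 :* (𝕒 :* 𝕓) :+ 𝕣 :* (𝕒 :* 𝕒))) images) ⟩
      intK (a₀ ℤ.* y)            ∎)
      where
      Y = A₀ * - (intK p * ((A₀ * x) * (A₀ * x)) + intK q * (A₀ * (A₀ * x)) + intK r * (A₀ * A₀))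

    ∣a₀∣≡1 : ∣ a₀ ∣ ≡ 1
    ∣a₀∣≡1 = coprime-∣-cube⇒unit {a₀} {b₀} coprime
      (ℤ∣ˢ.∣⇒∣ᵤ (ℤ∣ˢ.divides y (≡.trans b₀³≡a₀y (ℤP.*-comm a₀ y))))

    x≈a₀b₀ : x ≈ intK (a₀ ℤ.* b₀)
    x≈a₀b₀ = begin
      x                      ≈⟨ sym (trans (*-congʳ (intK-1 a₀²≡1)) (*-identityˡ x)) ⟩
      intK (a₀ ℤ.* a₀) * x   ≈⟨ *-congʳ (intK-* a₀ a₀) ⟩
      (A₀ * A₀) * x          ≈⟨ *-assoc A₀ A₀ x ⟩
      A₀ * (A₀ * x)          ≈⟨ *-congˡ a₀x≈b₀ ⟩
      A₀ * B₀                ≈⟨ sym (intK-* a₀ b₀) ⟩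
      intK (a₀ ℤ.* b₀)       ∎
      where
      a₀²≡1 = ∣i∣≡1⇒i*i≡1 {a₀} ∣a₀∣≡1
      intK-1 : ∀ {i} → i ≡ 1ℤ → intK i ≈ 1#
      intK-1 ≡.refl = +-identityʳ 1#

  unimodular-double-root-integral : ∀ {t e : ℤ} {l m} → ¬ l ≈ m → intK t ≈ l + m + m →
    intK e ≈ l * m + l * m + m * m → l * (m * m) ≈ 1# → ∃[ k ] m ≈ intK k
  unimodular-double-root-integral {t} {e} {l} {m} l≉m t↦T e↦E lm²≈1 =
    rational-root-integral {a} {b} {ℤ.- t} {e} { -1ℤ} a≢0 am≈b χ[m]≈0
    where
    T E : Carrier
    T = l + m + m
    E = l * m + l * m + m * m

    -- m = b / a is the usual formula for the double root of a cubic.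
    a b : ℤ
    a = + 2 ℤ.* (t ℤ.* t ℤ.- + 3 ℤ.* e)
    b = t ℤ.* e ℤ.- + 9

    𝕥 𝕖 : Polynomial 2
    𝕥 = var (# 0)
    𝕖 = var (# 1)

    images : Pointwise _↦_ (t ∷ e ∷ []) (T ∷ E ∷ [])
    images = t↦T ∷ e↦E ∷ []

    a↦ : intK a ≈ fromℤ (+ 2) * (T * T - fromℤ (+ 3) * E)
    a↦ = ⟦⟧-image (con (+ 2) :* (𝕥 :* 𝕥 :- con (+ 3) :* 𝕖)) images

    b↦ : intK b ≈ T * E - fromℤ (+ 9)
    b↦ = ⟦⟧-image (𝕥 :* 𝕖 :- con (+ 9)) images

    1-lm²≈0 : 1# - l * (m * m) ≈ 0#
    1-lm²≈0 = x≈y⇒x∙y⁻¹≈ε (sym lm²≈1)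

    a≢0 : a ≢ 0ℤ
    a≢0 a≡0 = *-nonzero (charZero 1) (*-nonzero (x≉y⇒x-y≉0 l≉m) (x≉y⇒x-y≉0 l≉m)) (begin
      fromℤ (+ 2) * ((l - m) * (l - m))    ≈⟨ solve 2 (λ l m → let T = l :+ m :+ m ; E = l :* m :+ l :* m :+ m :* m in
          con (+ 2) :* ((l :- m) :* (l :- m)) := con (+ 2) :* (T :* T :- con (+ 3) :* E)) refl l m ⟩
      fromℤ (+ 2) * (T * T - fromℤ (+ 3) * E) ≈⟨ sym a↦ ⟩
      intK a                               ≡⟨ ≡.cong intK a≡0 ⟩
      0#                                   ∎)

    am≈b : intK a * m ≈ intK b
    am≈b = begin
      intK a * m                                   ≈⟨ *-congʳ a↦ ⟩
      fromℤ (+ 2) * (T * T - fromℤ (+ 3) * E) * m  ≈⟨ solve 2 (λ l m → let T = l :+ m :+ m ; E = l :* m :+ l :* m :+ m :* m in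
          con (+ 2) :* (T :* T :- con (+ 3) :* E) :* m
            := T :* E :- con (+ 9) :+ con (+ 9) :* (con 1ℤ :- l :* (m :* m))) refl l m ⟩
      T * E - fromℤ (+ 9) + fromℤ (+ 9) * (1# - l * (m * m)) ≈⟨ y≈0⇒x+z*y≈x _ 1-lm²≈0 ⟩
      T * E - fromℤ (+ 9)                          ≈⟨ sym b↦ ⟩
      intK b                                       ∎

    χ[m]≈0 : m * m * m + intK (ℤ.- t) * (m * m) + intK e * m + intK -1ℤ ≈ 0#
    χ[m]≈0 = begin
      m * m * m + intK (ℤ.- t) * (m * m) + intK e * m + intK -1ℤ
        ≈⟨ +-cong (+-cong (+-congˡ (*-congʳ (trans (intK-neg t) (-‿cong t↦T)))) (*-congʳ e↦E))
                  (sym (fromℤ≈intK -1ℤ)) ⟩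
      m * m * m + - T * (m * m) + E * m + - 1#
        ≈⟨ solve 2 (λ l m → let T = l :+ m :+ m ; E = l :* m :+ l :* m :+ m :* m in
             m :* m :* m :+ :- T :* (m :* m) :+ E :* m :+ :- con 1ℤ := :- (con 1ℤ :- l :* (m :* m))) refl l m ⟩
      - (1# - l * (m * m))  ≈⟨ -‿cong 1-lm²≈0 ⟩
      - 0#                  ≈⟨ ε⁻¹≈ε ⟩
      0#                    ∎

  unimodular-double-root : ∀ {t e : ℤ} {l m} → ¬ l ≈ m → intK t ≈ l + m + m →
    intK e ≈ l * m + l * m + m * m → l * (m * m) ≈ 1# → l ≈ 1# × m ≈ - 1#
  unimodular-double-root {t} {e} {l} {m} l≉m t↦T e↦E lm²≈1 =
    from-integer (unimodular-double-root-integral {t} {e} l≉m t↦T e↦E lm²≈1)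
    where
    from-integer : ∃[ k ] m ≈ intK k → l ≈ 1# × m ≈ - 1#
    from-integer (k , m≈k) = l≈1 , m≈-1 (∣i∣≡1⇒i≡±1 {k} ∣k∣≡1)
      where
      j : ℤ
      j = t ℤ.- + 2 ℤ.* k

      j↦l : intK j ≈ l
      j↦l = begin
        intK j             ≈⟨ ⟦⟧-image (var (# 0) :- con (+ 2) :* var (# 1)) images ⟩
        l + m + m - fromℤ (+ 2) * m  ≈⟨ solve 2 (λ l m → l :+ m :+ m :- con (+ 2) :* m := l) refl l m ⟩
        l                  ∎
        where
        images : Pointwise _↦_ (t ∷ k ∷ []) (l + m + m ∷ m ∷ [])
        images = t↦T ∷ sym m≈k ∷ []

      j[kk]≡1 : j ℤ.* (k ℤ.* k) ≡ 1ℤ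
      j[kk]≡1 = intK-injective (begin
        intK (j ℤ.* (k ℤ.* k))     ≈⟨ trans (intK-* j (k ℤ.* k)) (*-cong j↦l (intK-* k k)) ⟩
        l * (intK k * intK k)     ≈⟨ *-congˡ (sym (*-cong m≈k m≈k)) ⟩
        l * (m * m)               ≈⟨ lm²≈1 ⟩
        1#                        ≈⟨ fromℤ≈intK 1ℤ ⟩
        intK 1ℤ                   ∎)

      j≡1 = proj₁ (i*[j*j]≡1⇒i≡1×∣j∣≡1 j k j[kk]≡1)
      ∣k∣≡1 = proj₂ (i*[j*j]≡1⇒i≡1×∣j∣≡1 j k j[kk]≡1)

      l≈1 : l ≈ 1#
      l≈1 = trans (sym j↦l) (trans (reflexive (≡.cong intK j≡1)) (sym (fromℤ≈intK 1ℤ)))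

      m≈-1 : k ≡ 1ℤ ⊎ k ≡ -1ℤ → m ≈ - 1#
      m≈-1 (inj₁ ≡.refl) = ⊥-elim (l≉m (trans l≈1 (trans (fromℤ≈intK 1ℤ) (sym m≈k))))
      m≈-1 (inj₂ ≡.refl) = trans m≈k (sym (fromℤ≈intK -1ℤ))

  mapK-⊗ : ∀ A B → mapK (A ⊗ℤ B) ≋ (mapK A ⊗ mapK B)
  mapK-⊗ A B i j = begin
    intK (A i i0 ℤ.* B i0 j ℤ.+ A i i1 ℤ.* B i1 j ℤ.+ A i i2 ℤ.* B i2 j)
      ≈⟨ trans (intK-+ (A i i0 ℤ.* B i0 j ℤ.+ A i i1 ℤ.* B i1 j) _) (+-congʳ (intK-+ (A i i0 ℤ.* B i0 j) _)) ⟩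
    intK (A i i0 ℤ.* B i0 j) + intK (A i i1 ℤ.* B i1 j) + intK (A i i2 ℤ.* B i2 j)
      ≈⟨ +-cong (+-cong (intK-* (A i i0) (B i0 j)) (intK-* (A i i1) (B i1 j))) (intK-* (A i i2) (B i2 j)) ⟩
    (mapK A ⊗ mapK B) i j ∎

  ⊗-cong : ∀ {A A′ B B′} → A ≋ A′ → B ≋ B′ → (A ⊗ B) ≋ (A′ ⊗ B′)
  ⊗-cong A≋A′ B≋B′ i j =
    +-cong (+-cong (*-cong (A≋A′ i i0) (B≋B′ i0 j)) (*-cong (A≋A′ i i1) (B≋B′ i1 j)))
           (*-cong (A≋A′ i i2) (B≋B′ i2 j))

  ⊗-congˡ : ∀ A {B B′} → B ≋ B′ → (A ⊗ B) ≋ (A ⊗ B′)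
  ⊗-congˡ A = ⊗-cong {A} {A} (λ _ _ → refl)

  ⊗-identityʳ : ∀ A → (A ⊗ idK) ≋ A
  ⊗-identityʳ A i fz =
    solve 3 (λ a b c → a :* con 1ℤ :+ b :* con 0ℤ :+ c :* con 0ℤ := a) refl (A i i0) (A i i1) (A i i2)
  ⊗-identityʳ A i (fs fz) =
    solve 3 (λ a b c → a :* con 0ℤ :+ b :* con 1ℤ :+ c :* con 0ℤ := b) refl (A i i0) (A i i1) (A i i2)
  ⊗-identityʳ A i (fs (fs fz)) =
    solve 3 (λ a b c → a :* con 0ℤ :+ b :* con 0ℤ :+ c :* con 1ℤ := c) refl (A i i0) (A i i1) (A i i2)

  diagonalisable⇒rankOne : ∀ {l m P Q} → (P ⊗ Q) ≋ idK →
    ((P ⊗ diag3 l m m) ⊗ Q) ≋ Kᴹ.rankOne idK m (l - m) (λ i → P i i0) (Q i0)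
  diagonalisable⇒rankOne {l} {m} {P} {Q} PQ≋I i j = begin
    ((P ⊗ diag3 l m m) ⊗ Q) i j                        ≈⟨ split ⟩
    m * (P ⊗ Q) i j + (l - m) * (P i i0 * Q i0 j)      ≈⟨ +-congʳ (*-congˡ (PQ≋I i j)) ⟩
    m * idK i j + (l - m) * (P i i0 * Q i0 j)          ∎
    where
    split = solve 8 (λ l m p₀ p₁ p₂ q₀ q₁ q₂ →
        let 𝕡 = λ _ → vec3 p₀ p₁ p₂ ; 𝕢 = λ b _ → vec3 q₀ q₁ q₂ b in
        ((𝕡 Pᴹ.· Pᴹ.diag l m m) Pᴹ.· 𝕢) i j
          := m :* (𝕡 Pᴹ.· 𝕢) i j :+ (l :- m) :* (𝕡 i i0 :* 𝕢 i0 j))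
      refl l m (P i i0) (P i i1) (P i i2) (Q i0 j) (Q i1 j) (Q i2 j)

  module RankOne (m c : Carrier) (u w : Fin 3 → Carrier) where
    R : Mat3 Carrier
    R = Kᴹ.rankOne idK m c u w

    -- R u = λ₁ u; the other eigenvalue is m, on the plane orthogonal to w.
    λ₁ : Carrier
    λ₁ = m + c * (w Kᴹ.∙ u)

    private
      ρ : Vec Carrier 8
      ρ = m ∷ c ∷ u i0 ∷ u i1 ∷ u i2 ∷ w i0 ∷ w i1 ∷ w i2 ∷ []
      𝕞 𝕔 𝕝 : Polynomial 8
      𝕞 = var (# 0)
      𝕔 = var (# 1)
      𝕦 𝕨 : Fin 3 → Polynomial 8
      𝕦 = vec3 (var (# 2)) (var (# 3)) (var (# 4))
      𝕨 = vec3 (var (# 5)) (var (# 6)) (var (# 7))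
      𝕝 = 𝕞 :+ 𝕔 :* (𝕨 Pᴹ.∙ 𝕦)
      ℝ ℝ² : Mat3 (Polynomial 8)
      ℝ = Pᴹ.rankOne Pᴹ.1ᴹ 𝕞 𝕔 𝕦 𝕨
      ℝ² = Pᴹ.rankOne Pᴹ.1ᴹ (𝕞 :* 𝕞) (𝕔 :* (𝕝 :+ 𝕞)) 𝕦 𝕨

      entry : ∀ i j → ⟦ (ℝ Pᴹ.· ℝ) i j ⟧↓ ρ ≈ ⟦ ℝ² i j ⟧↓ ρ → ⟦ (ℝ Pᴹ.· ℝ) i j ⟧ ρ ≈ ⟦ ℝ² i j ⟧ ρ
      entry i j = prove ρ ((ℝ Pᴹ.· ℝ) i j) (ℝ² i j)

    tr-R : Kᴹ.tr R ≈ λ₁ + m + m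
    tr-R = prove ρ (Pᴹ.tr ℝ) (𝕝 :+ 𝕞 :+ 𝕞) refl

    e₂-R : Kᴹ.e₂ R ≈ λ₁ * m + λ₁ * m + m * m
    e₂-R = prove ρ (Pᴹ.e₂ ℝ) (𝕝 :* 𝕞 :+ 𝕝 :* 𝕞 :+ 𝕞 :* 𝕞) refl

    det-R : Kᴹ.det R ≈ λ₁ * (m * m)
    det-R = prove ρ (Pᴹ.det ℝ) (𝕝 :* (𝕞 :* 𝕞)) refl

    -- Row and column of idK at an abstract index do not compute, so the solver
    -- is run at each of the nine positions.
    R⊗R≋rankOne : (R ⊗ R) ≋ Kᴹ.rankOne idK (m * m) (c * (λ₁ + m)) u w
    R⊗R≋rankOne fz fz = entry fz fz refl
    R⊗R≋rankOne fz (fs fz) = entry fz (fs fz) refl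
    R⊗R≋rankOne fz (fs (fs fz)) = entry fz (fs (fs fz)) refl
    R⊗R≋rankOne (fs fz) fz = entry (fs fz) fz refl
    R⊗R≋rankOne (fs fz) (fs fz) = entry (fs fz) (fs fz) refl
    R⊗R≋rankOne (fs fz) (fs (fs fz)) = entry (fs fz) (fs (fs fz)) refl
    R⊗R≋rankOne (fs (fs fz)) fz = entry (fs (fs fz)) fz refl
    R⊗R≋rankOne (fs (fs fz)) (fs fz) = entry (fs (fs fz)) (fs fz) refl
    R⊗R≋rankOne (fs (fs fz)) (fs (fs fz)) = entry (fs (fs fz)) (fs (fs fz)) refl

    R⊗R≋idK : λ₁ ≈ 1# → m ≈ - 1# → (R ⊗ R) ≋ idK
    R⊗R≋idK λ₁≈1 m≈-1 i j = begin
      (R ⊗ R) i j                                           ≈⟨ R⊗R≋rankOne i j ⟩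
      (m * m) * idK i j + (c * (λ₁ + m)) * (u i * w j)      ≈⟨ +-cong (*-congʳ m²≈1) (*-congʳ c[λ₁+m]≈0) ⟩
      1# * idK i j + 0# * (u i * w j)                       ≈⟨ +-cong (*-identityˡ _) (zeroˡ _) ⟩
      idK i j + 0#                                          ≈⟨ +-identityʳ _ ⟩
      idK i j                                               ∎
      where
      m²≈1 : m * m ≈ 1#
      m²≈1 = trans (*-cong m≈-1 m≈-1) (solve 0 (con -1ℤ :* con -1ℤ := con 1ℤ) refl)
      c[λ₁+m]≈0 : c * (λ₁ + m) ≈ 0#
      c[λ₁+m]≈0 = trans (*-congˡ (trans (+-cong λ₁≈1 m≈-1) (-‿inverseʳ 1#))) (zeroʳ c)

  cube-of-involution : ∀ {M R} → mapK M ≋ R → (R ⊗ R) ≋ idK → (M ⊗ℤ (M ⊗ℤ M)) ≈ℤ M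
  cube-of-involution {M} {R} M≋R R²≋I i j = intK-injective (begin
    intK ((M ⊗ℤ (M ⊗ℤ M)) i j)         ≈⟨ trans (mapK-⊗ M (M ⊗ℤ M) i j) (⊗-congˡ N (mapK-⊗ M M) i j) ⟩
    (N ⊗ (N ⊗ N)) i j                  ≈⟨ ⊗-congˡ N (⊗-cong M≋R M≋R) i j ⟩
    (N ⊗ (R ⊗ R)) i j                  ≈⟨ ⊗-congˡ N R²≋I i j ⟩
    (N ⊗ idK) i j                      ≈⟨ ⊗-identityʳ N i j ⟩
    intK (M i j)                       ∎)
    where
    N = mapK M

  jnf⇒cube : ∀ M → detℤ M ≡ + 1 → HasJNF-λμμ K M → (M ⊗ℤ (M ⊗ℤ M)) ≈ℤ M
  jnf⇒cube M det≡1 (l , m , l≉m , P , Q , PQ≋I , QP≋I , M≋PDQ) =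
    cube-of-involution M≋R (R⊗R≋idK (trans λ₁≈l (proj₁ l≈1×m≈-1)) (proj₂ l≈1×m≈-1))
    where
    open RankOne m (l - m) (λ i → P i i0) (Q i0)

    M≋R : mapK M ≋ R
    M≋R i j = trans (M≋PDQ i j) (diagonalisable⇒rankOne {l} {m} {P} {Q} PQ≋I i j)

    λ₁≈l : λ₁ ≈ l
    λ₁≈l = trans (+-congˡ (*-congˡ (QP≋I i0 i0)))
      (solve 2 (λ l m → m :+ (l :- m) :* con 1ℤ := l) refl l m)

    t↦ : intK (ℤᴹ.tr M) ≈ l + m + m
    t↦ = trans (⟦⟧-image (Pᴹ.tr 𝕄) (entries-image {M} M≋R)) (trans tr-R (+-congʳ (+-congʳ λ₁≈l)))

    e↦ : intK (ℤᴹ.e₂ M) ≈ l * m + l * m + m * m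
    e↦ = trans (⟦⟧-image (Pᴹ.e₂ 𝕄) (entries-image {M} M≋R))
      (trans e₂-R (+-cong (+-cong (*-congʳ λ₁≈l) (*-congʳ λ₁≈l)) refl))

    lm²≈1 : l * (m * m) ≈ 1#
    lm²≈1 = begin
      l * (m * m)        ≈⟨ *-congʳ (sym λ₁≈l) ⟩
      λ₁ * (m * m)       ≈⟨ sym det-R ⟩
      Kᴹ.det R           ≈⟨ sym (⟦⟧-image (Pᴹ.det 𝕄) (entries-image {M} M≋R)) ⟩
      intK (detℤ M)      ≡⟨ ≡.cong intK det≡1 ⟩
      intK (+ 1)         ≈⟨ +-identityʳ 1# ⟩
      1#                 ∎

    l≈1×m≈-1 : l ≈ 1# × m ≈ - 1#
    l≈1×m≈-1 = unimodular-double-root {ℤᴹ.tr M} {ℤᴹ.e₂ M} l≉m t↦ e↦ lm²≈1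

_³ : Word2 → Word2
(x₁ , x₂) ³ = x₁ ++ x₁ ++ x₁ , x₂ ++ x₂ ++ x₂

⊗ℤ-congˡ : ∀ A {B B′} → B ≈ℤ B′ → (A ⊗ℤ B) ≈ℤ (A ⊗ℤ B′)
⊗ℤ-congˡ A B≈B′ i j = ≡.cong₂ ℤ._+_
  (≡.cong₂ ℤ._+_ (≡.cong (A i i0 ℤ.*_) (B≈B′ i0 j)) (≡.cong (A i i1 ℤ.*_) (B≈B′ i1 j)))
  (≡.cong (A i i2 ℤ.*_) (B≈B′ i2 j))

morphism-³ : ∀ {φ} → IsMorphism φ → ∀ x → φ (x ³) ≈ℤ (φ x ⊗ℤ (φ x ⊗ℤ φ x))
morphism-³ {φ} hom (x₁ , x₂) i j = ≡.trans (hom x₁ x₂ (x₁ ++ x₁) (x₂ ++ x₂) i j)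
  (⊗ℤ-congˡ (φ (x₁ , x₂)) (hom x₁ x₂ x₁ x₂) i j)

lemma8 : (φ : Word2 → Mat3 ℤ) → IntoSL3 φ → IsMorphism φ → IsInjective φ →
    ∀ {c ℓ : Level} (K : CharZeroField c ℓ) →
      ¬ HasJNF-λμμ K (φ ([ false ] , [])) × ¬ HasJNF-λμμ K (φ ([ true ] , [])) ×
      ¬ HasJNF-λμμ K (φ ([] , [ false ])) × ¬ HasJNF-λμμ K (φ ([] , [ true ]))
lemma8 φ det≡1 hom inj K =
  no-jnf ([ false ] , []) (λ ()) , no-jnf ([ true ] , []) (λ ()) ,
  no-jnf ([] , [ false ]) (λ ()) , no-jnf ([] , [ true ]) (λ ())
  where
  no-jnf : ∀ x → x ³ ≢ x → ¬ HasJNF-λμμ K (φ x)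
  no-jnf x x³≢x jnf =
    x³≢x (inj (x ³) x (λ i j → ≡.trans (morphism-³ {φ} hom x i j) (jnf⇒cube K (φ x) (det≡1 x) jnf i j)))
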